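{- Let $n \ge m \ge 1$ be integers. Then the outcome of the Maker-Breaker domination game on the complete bipartite graph $K_{m,n}$ is $\mathcal{D}$ if $n=m=1$ or if $n,m \ge 2$, and it is $\mathcal{N}$ if $n > m = 1$.
   Context: The Maker-Breaker domination game on a finite graph $G$ is played by Dominator and Staller, who alternately claim a previously unplayed vertex of $G$ until all vertices are played. Dominator wins if his claimed vertices form a dominating set of $G$; otherwise Staller wins (equivalently, she claims all vertices of some closed neighborhood $N_G[v]$). The D-game is the game where Dominator moves first, the S-game where Staller moves first. The outcome $o(G)$ is $\mathcal{D}$ if Dominator has a winning strategy in both the D-game and the S-game, $\mathcal{S}$ if Staller has a winning strategy in both games, and $\mathcal{N}$ if the player who moves first has a winning strategy in each of the two games. -}

module Defs where

open import Data.Nat using (ℕ; _+_; _<_; _≤_)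
open import Data.Fin using (Fin; toℕ; _≟_)
open import Data.Product using (Σ; _×_; ∃)
open import Data.Sum using (_⊎_)
open import Relation.Nullary using (¬_; yes; no)
open import Relation.Binary.PropositionalEquality using (_≡_; _≢_)

record Graph : Set₁ where
  field
    order : ℕ
    Adj   : Fin order → Fin order → Set

open Graph public

K : ℕ → ℕ → Graph
K m n = record
  { order = m + n
  ; Adj   = λ u v → (toℕ u < m × m ≤ toℕ v) ⊎ (m ≤ toℕ u × toℕ v < m)
  }

data Mark : Set where
  free dom stal : Mark

Position : Graph → Set
Position G = Fin (order G) → Mark

initial : (G : Graph) → Position G
initial G _ = free

claim : (G : Graph) → Position G → Fin (order G) → Mark → Position G
claim G s v c w with w ≟ v
... | yes _ = c
... | no  _ = s w

AllPlayed : (G : Graph) → Position G → Set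
AllPlayed G s = ∀ v → s v ≢ free

InClosedNbhd : (G : Graph) → Fin (order G) → Fin (order G) → Set
InClosedNbhd G v u = u ≡ v ⊎ Adj G u v

Dominated : (G : Graph) → Position G → Set
Dominated G s = ∀ v → ∃ λ u → s u ≡ dom × InClosedNbhd G v u

-- Positions from which Dominator has a winning strategy,
-- with Dominator (DWinD) resp. Staller (DWinS) to move.
mutual
  data DWinD (G : Graph) (s : Position G) : Set where
    endD  : AllPlayed G s → Dominated G s → DWinD G s
    moveD : (v : Fin (order G)) → s v ≡ free → DWinS G (claim G s v dom) → DWinD G s

  data DWinS (G : Graph) (s : Position G) : Set where
    endS  : AllPlayed G s → Dominated G s → DWinS G s
    moveS : ¬ AllPlayed G s →
            ((v : Fin (order G)) → s v ≡ free → DWinD G (claim G s v stal)) → DWinS G s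

mutual
  data SWinD (G : Graph) (s : Position G) : Set where
    endD  : AllPlayed G s → ¬ Dominated G s → SWinD G s
    moveD : ¬ AllPlayed G s →
            ((v : Fin (order G)) → s v ≡ free → SWinS G (claim G s v dom)) → SWinD G s

  data SWinS (G : Graph) (s : Position G) : Set where
    endS  : AllPlayed G s → ¬ Dominated G s → SWinS G s
    moveS : (v : Fin (order G)) → s v ≡ free → SWinD G (claim G s v stal) → SWinS G s

-- D-game: Dominator moves first; S-game: Staller moves first.
DominatorWinsDGame DominatorWinsSGame StallerWinsDGame StallerWinsSGame : Graph → Set
DominatorWinsDGame G = DWinD G (initial G)
DominatorWinsSGame G = DWinS G (initial G)
StallerWinsDGame   G = SWinD G (initial G)
StallerWinsSGame   G = SWinS G (initial G)

data Outcome : Set where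
  𝒟 𝒩 𝒮 : Outcome

OutcomeIs : Graph → Outcome → Set
OutcomeIs G 𝒟 = DominatorWinsDGame G × DominatorWinsSGame G
OutcomeIs G 𝒮 = StallerWinsDGame G × StallerWinsSGame G
OutcomeIs G 𝒩 = DominatorWinsDGame G × StallerWinsSGame G

{-# OPTIONS --safe #-}
module Submission where

-- Dominator wins on K₁,₁ and on K_{m,n} with m, n ≥ 2 by a pairing strategy: he fixes disjoint pairs
-- such that every closed neighbourhood contains a whole pair (two vertices on each side, resp. the
-- two vertices of K₁,₁) and answers Staller's move in a pair by its partner, so he ends up owning a
-- vertex of every pair. On a star K_{1,n} with n ≥ 2 the first player takes the centre: Dominator
-- thereby dominates, while Staller, holding the centre, next takes a leaf Dominator has not taken and
-- so owns its closed neighbourhood.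

open import Defs
open import Data.Nat using (ℕ; zero; suc; _+_; _≤_; _<_; z≤n; s≤s; _<?_)
open import Data.Nat.Properties using (≤-refl; <-trans; ≮⇒≥; <⇒≱; m≤m+n; +-monoʳ-<)
open import Data.Nat.Induction using (<-wellFounded)
open import Induction.WellFounded using (Acc; acc)
open import Data.Fin using (Fin; zero; suc; toℕ; _≟_; _↑ˡ_; _↑ʳ_)
open import Data.Fin.Properties using (any?; suc-injective; toℕ<n; toℕ-↑ˡ; toℕ-↑ʳ; ↑ˡ-injective; ↑ʳ-injective)
open import Data.Product using (Σ; ∃; _×_; _,_)
open import Data.Sum using (_⊎_; inj₁; inj₂)
open import Function using (_∘_)
open import Relation.Nullary using (¬_; Dec; yes; no; contradiction)
open import Relation.Nullary.Decidable using (_⊎-dec_)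
open import Relation.Binary.PropositionalEquality using (_≡_; _≢_; refl; sym; trans; cong; cong₂; subst)

free? : (c : Mark) → Dec (c ≡ free)
free? free = yes refl
free? dom  = no λ ()
free? stal = no λ ()

isFree : Mark → ℕ
isFree free = 1
isFree dom  = 0
isFree stal = 0

isFree-played : ∀ {c} → c ≢ free → isFree c ≡ 0
isFree-played {free} c≢free = contradiction refl c≢free
isFree-played {dom}  _      = refl
isFree-played {stal} _      = refl

freeCount : ∀ {N} → (Fin N → Mark) → ℕ
freeCount {zero}  s = 0
freeCount {suc N} s = isFree (s zero) + freeCount (s ∘ suc)

freeCount-cong : ∀ {N} {f g : Fin N → Mark} → (∀ w → f w ≡ g w) → freeCount f ≡ freeCount g
freeCount-cong {zero}  f≗g = refl
freeCount-cong {suc N} f≗g = cong₂ _+_ (cong isFree (f≗g zero)) (freeCount-cong (f≗g ∘ suc))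

freeCount-< : ∀ {N} {f g : Fin N → Mark} v → (∀ w → w ≢ v → f w ≡ g w) →
              f v ≢ free → g v ≡ free → freeCount f < freeCount g
freeCount-< {suc N} {f} {g} zero f≈g fv gv
  rewrite isFree-played fv | gv | freeCount-cong {f = f ∘ suc} {g ∘ suc} (λ w → f≈g (suc w) λ ())
  = ≤-refl
freeCount-< {suc N} {f} {g} (suc v) f≈g fv gv
  rewrite f≈g zero (λ ())
  = +-monoʳ-< (isFree (g zero)) (freeCount-< v (λ w w≢v → f≈g (suc w) (w≢v ∘ suc-injective)) fv gv)

module _ (G : Graph) where

  claim-updates : ∀ s v c → claim G s v c v ≡ c
  claim-updates s v c with v ≟ v
  ... | yes _   = refl
  ... | no v≢v = contradiction refl v≢v

  claim-minimal : ∀ s v c {w} → w ≢ v → claim G s v c w ≡ s w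
  claim-minimal s v c {w} w≢v with w ≟ v
  ... | yes w≡v = contradiction w≡v w≢v
  ... | no _    = refl

  claim-cases : ∀ s v c w → claim G s v c w ≡ c ⊎ claim G s v c w ≡ s w
  claim-cases s v c w with w ≟ v
  ... | yes _ = inj₁ refl
  ... | no _  = inj₂ refl

  claim-keeps : ∀ s v c w {c′} → s v ≡ free → s w ≡ c′ → c′ ≢ free → claim G s v c w ≡ c′
  claim-keeps s v c w sv sw c′≢free =
    trans (claim-minimal s v c λ { refl → c′≢free (trans (sym sw) sv) }) sw

  freeCount-claim : ∀ {s v c} → s v ≡ free → c ≢ free → freeCount (claim G s v c) < freeCount s
  freeCount-claim {s} {v} {c} sv c≢free =
    freeCount-< v (λ w → claim-minimal s v c) (λ e → c≢free (trans (sym (claim-updates s v c)) e)) sv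

  someFree? : (s : Position G) → Dec (∃ λ v → s v ≡ free)
  someFree? s = any? (free? ∘ s)

  allPlayed : ∀ {s} → ¬ (∃ λ v → s v ≡ free) → AllPlayed G s
  allPlayed none v sv = none (v , sv)

  Answerable : (Position G → Set) → Position G → Fin (order G) → Set
  Answerable I s v = I (claim G s v stal) ⊎
                     ∃ λ w → claim G s v stal w ≡ free × I (claim G (claim G s v stal) w dom)

  Answerable-map : ∀ {I J : Position G → Set} {s v} → (∀ {t} → I t → J t) → Answerable I s v → Answerable J s v
  Answerable-map f (inj₁ i)           = inj₁ (f i)
  Answerable-map f (inj₂ (w , sw , i)) = inj₂ (w , sw , f i)

  record DominatorInvariant (I : Position G → Set) : Set where
    field
      dominates : ∀ {s} → AllPlayed G s → I s → Dominated G s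
      after-dom : ∀ {s v} → s v ≡ free → I s → I (claim G s v dom)
      answer    : ∀ {s v} → s v ≡ free → I s → Answerable I s v

  module _ {I : Position G → Set} (inv : DominatorInvariant I) where
    open DominatorInvariant inv

    invariant⇒DWinD : ∀ {s} → Acc _<_ (freeCount s) → I s → DWinD G s
    invariant⇒DWinS : ∀ {s} → Acc _<_ (freeCount s) → I s → DWinS G s

    invariant⇒DWinD {s} (acc rs) i with someFree? s
    ... | yes (v , sv) = moveD v sv (invariant⇒DWinS (rs (freeCount-claim sv λ ())) (after-dom sv i))
    ... | no none      = endD (allPlayed none) (dominates (allPlayed none) i)

    invariant⇒DWinS {s} (acc rs) i with someFree? s
    ... | no none      = endS (allPlayed none) (dominates (allPlayed none) i)
    ... | yes (v , sv) = moveS (λ ap → ap v sv) respond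
      where
        respond : ∀ w → s w ≡ free → DWinD G (claim G s w stal)
        respond w sw with answer sw i
        ... | inj₁ i′ = invariant⇒DWinD (rs (freeCount-claim sw λ ())) i′
        ... | inj₂ (u , su , i′) =
          moveD u su (invariant⇒DWinS (rs (<-trans (freeCount-claim su λ ()) (freeCount-claim sw λ ()))) i′)

    invariant⇒𝒟 : I (initial G) → OutcomeIs G 𝒟
    invariant⇒𝒟 i = invariant⇒DWinD (<-wellFounded _) i , invariant⇒DWinS (<-wellFounded _) i

  Dominated-claim : ∀ {s v c} → s v ≡ free → Dominated G s → Dominated G (claim G s v c)
  Dominated-claim {s} {v} {c} sv d x with d x
  ... | u , su , u∈N[x] = u , claim-keeps s v c u sv su (λ ()) , u∈N[x]

  dominatedInvariant : DominatorInvariant (Dominated G)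
  dominatedInvariant = record
    { dominates = λ _ d → d
    ; after-dom = Dominated-claim
    ; answer    = λ sv d → inj₁ (Dominated-claim sv d)
    }

  dominated⇒DWinS : ∀ {s} → Dominated G s → DWinS G s
  dominated⇒DWinS = invariant⇒DWinS dominatedInvariant (<-wellFounded _)

  OwnsClosedNbhd : Position G → Fin (order G) → Set
  OwnsClosedNbhd s v = ∀ {u} → InClosedNbhd G v u → s u ≡ stal

  OwnsClosedNbhd-claim : ∀ {s v w c} → s w ≡ free → OwnsClosedNbhd s v → OwnsClosedNbhd (claim G s w c) v
  OwnsClosedNbhd-claim {s} {w = w} {c} sw owns {u} u∈N[v] = claim-keeps s w c u sw (owns u∈N[v]) (λ ())

  owns⇒¬Dominated : ∀ {s v} → OwnsClosedNbhd s v → ¬ Dominated G s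
  owns⇒¬Dominated {v = v} owns d with d v
  ... | u , su , u∈N[v] with trans (sym su) (owns u∈N[v])
  ... | ()

  owns⇒SWinD : ∀ {s v} → Acc _<_ (freeCount s) → OwnsClosedNbhd s v → SWinD G s
  owns⇒SWinS : ∀ {s v} → Acc _<_ (freeCount s) → OwnsClosedNbhd s v → SWinS G s

  owns⇒SWinD {s} (acc rs) owns with someFree? s
  ... | yes (v , sv) = moveD (λ ap → ap v sv) λ w sw →
                         owns⇒SWinS (rs (freeCount-claim sw λ ())) (OwnsClosedNbhd-claim sw owns)
  ... | no none      = endD (allPlayed none) (owns⇒¬Dominated owns)

  owns⇒SWinS {s} (acc rs) owns with someFree? s
  ... | yes (v , sv) = moveS v sv (owns⇒SWinD (rs (freeCount-claim sv λ ())) (OwnsClosedNbhd-claim sv owns))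
  ... | no none      = endS (allPlayed none) (owns⇒¬Dominated owns)

  data Intact (s : Position G) (x y : Fin (order G)) : Set where
    left-dom  : s x ≡ dom → Intact s x y
    right-dom : s y ≡ dom → Intact s x y
    both-free : s x ≡ free → s y ≡ free → Intact s x y

  Intact-sym : ∀ {s x y} → Intact s x y → Intact s y x
  Intact-sym (left-dom sx)     = right-dom sx
  Intact-sym (right-dom sy)    = left-dom sy
  Intact-sym (both-free sx sy) = both-free sy sx

  claim-dom-keeps : ∀ s w {x} → s x ≡ dom → claim G s w dom x ≡ dom
  claim-dom-keeps s w {x} sx with claim-cases s w dom x
  ... | inj₁ e = e
  ... | inj₂ e = trans e sx

  Intact-claim-dom : ∀ {s w x y} → Intact s x y → Intact (claim G s w dom) x y
  Intact-claim-dom {s} {w} (left-dom sx)  = left-dom (claim-dom-keeps s w sx)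
  Intact-claim-dom {s} {w} (right-dom sy) = right-dom (claim-dom-keeps s w sy)
  Intact-claim-dom {s} {w} {x} {y} (both-free sx sy) with claim-cases s w dom x | claim-cases s w dom y
  ... | inj₁ e  | _       = left-dom e
  ... | inj₂ _  | inj₁ e  = right-dom e
  ... | inj₂ ex | inj₂ ey = both-free (trans ex sx) (trans ey sy)

  Intact-claim-outside : ∀ {s w c x y} → x ≢ w → y ≢ w → Intact s x y → Intact (claim G s w c) x y
  Intact-claim-outside {s} {w} {c} x≢w y≢w i with claim-minimal s w c x≢w | claim-minimal s w c y≢w
  Intact-claim-outside x≢w y≢w (left-dom sx)     | ex | ey = left-dom (trans ex sx)
  Intact-claim-outside x≢w y≢w (right-dom sy)    | ex | ey = right-dom (trans ey sy)
  Intact-claim-outside x≢w y≢w (both-free sx sy) | ex | ey = both-free (trans ex sx) (trans ey sy)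

  Intact-answer-first : ∀ {s x y} → x ≢ y → s x ≡ free → Intact s x y → Answerable (λ t → Intact t x y) s x
  Intact-answer-first x≢y sx (left-dom sx′) with trans (sym sx′) sx
  ... | ()
  Intact-answer-first {s} {x} x≢y sx (right-dom sy) =
    inj₁ (right-dom (trans (claim-minimal s x stal (x≢y ∘ sym)) sy))
  Intact-answer-first {s} {x} {y} x≢y sx (both-free _ sy) =
    inj₂ (y , trans (claim-minimal s x stal (x≢y ∘ sym)) sy , right-dom (claim-updates _ y dom))

  Intact-answer : ∀ {s v x y} → x ≢ y → v ≡ x ⊎ v ≡ y → s v ≡ free → Intact s x y →
                  Answerable (λ t → Intact t x y) s v
  Intact-answer x≢y (inj₁ refl) sx i = Intact-answer-first x≢y sx i
  Intact-answer {x = x} {y} x≢y (inj₂ refl) sy i =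
    Answerable-map {I = λ t → Intact t y x} Intact-sym (Intact-answer-first (x≢y ∘ sym) sy (Intact-sym i))

record PairingDominatingSet (G : Graph) : Set where
  field
    size          : ℕ
    first second  : Fin size → Fin (order G)
    first≢second  : ∀ i → first i ≢ second i
    disjoint      : ∀ {i j v} → v ≡ first i ⊎ v ≡ second i → v ≡ first j ⊎ v ≡ second j → i ≡ j
    covers        : ∀ v → ∃ λ i → InClosedNbhd G v (first i) × InClosedNbhd G v (second i)

module _ {G : Graph} (P : PairingDominatingSet G) where
  open PairingDominatingSet P

  AllIntact : Position G → Set
  AllIntact s = ∀ i → Intact G s (first i) (second i)

  AllIntact-patch : ∀ {s} i → (∀ j → j ≢ i → Intact G s (first j) (second j)) →
                    Intact G s (first i) (second i) → AllIntact s
  AllIntact-patch i others here j with j ≟ i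
  ... | yes refl = here
  ... | no j≢i   = others j j≢i

  AllIntact⇒Dominated : ∀ {s} → AllPlayed G s → AllIntact s → Dominated G s
  AllIntact⇒Dominated ap intact v with covers v
  ... | i , first∈N[v] , second∈N[v] with intact i
  ...   | left-dom sx     = first i , sx , first∈N[v]
  ...   | right-dom sy    = second i , sy , second∈N[v]
  ...   | both-free sx _ = contradiction sx (ap (first i))

  AllIntact-claim-elsewhere : ∀ {s v c i} → v ≡ first i ⊎ v ≡ second i → AllIntact s →
                              ∀ j → j ≢ i → Intact G (claim G s v c) (first j) (second j)
  AllIntact-claim-elsewhere v∈i intact j j≢i =
    Intact-claim-outside G (λ e → j≢i (disjoint (inj₁ (sym e)) v∈i)) (λ e → j≢i (disjoint (inj₂ (sym e)) v∈i)) (intact j)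

  AllIntact-answer : ∀ {s v} → s v ≡ free → AllIntact s → Answerable G AllIntact s v
  AllIntact-answer {s} {v} sv intact with any? (λ i → (v ≟ first i) ⊎-dec (v ≟ second i))
  ... | no v∉pairs =
    inj₁ λ j → Intact-claim-outside G (λ e → v∉pairs (j , inj₁ (sym e))) (λ e → v∉pairs (j , inj₂ (sym e))) (intact j)
  ... | yes (i , v∈i) with Intact-answer G (first≢second i) v∈i sv (intact i)
  ...   | inj₁ here           = inj₁ (AllIntact-patch i (AllIntact-claim-elsewhere v∈i intact) here)
  ...   | inj₂ (w , sw , here) =
    inj₂ (w , sw , AllIntact-patch i (λ j j≢i → Intact-claim-dom G (AllIntact-claim-elsewhere v∈i intact j j≢i)) here)

  pairingInvariant : DominatorInvariant G AllIntact
  pairingInvariant = record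
    { dominates = AllIntact⇒Dominated
    ; after-dom = λ _ intact j → Intact-claim-dom G (intact j)
    ; answer    = AllIntact-answer
    }

  pairingDominatingSet⇒𝒟 : OutcomeIs G 𝒟
  pairingDominatingSet⇒𝒟 = invariant⇒𝒟 G pairingInvariant λ i → both-free refl refl

module _ {m n : ℕ} where

  ↑ˡ-onLeft : (a : Fin m) → toℕ (a ↑ˡ n) < m
  ↑ˡ-onLeft a = subst (_< m) (sym (toℕ-↑ˡ a n)) (toℕ<n a)

  ↑ʳ-onRight : (b : Fin n) → m ≤ toℕ (m ↑ʳ b)
  ↑ʳ-onRight b = subst (m ≤_) (sym (toℕ-↑ʳ m b)) (m≤m+n m (toℕ b))

  bipartitePairing : {a₁ a₂ : Fin m} {b₁ b₂ : Fin n} → a₁ ≢ a₂ → b₁ ≢ b₂ → PairingDominatingSet (K m n)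
  bipartitePairing {a₁} {a₂} {b₁} {b₂} a₁≢a₂ b₁≢b₂ = record
    { size         = 2
    ; first        = first
    ; second       = second
    ; first≢second = first≢second
    ; disjoint     = disjoint
    ; covers       = covers
    }
    where
      first second : Fin 2 → Fin (m + n)
      first  zero       = a₁ ↑ˡ n
      first  (suc zero) = m ↑ʳ b₁
      second zero       = a₂ ↑ˡ n
      second (suc zero) = m ↑ʳ b₂

      first≢second : ∀ i → first i ≢ second i
      first≢second zero       = a₁≢a₂ ∘ ↑ˡ-injective n a₁ a₂
      first≢second (suc zero) = b₁≢b₂ ∘ ↑ʳ-injective m b₁ b₂

      onLeft : ∀ {v} → v ≡ first zero ⊎ v ≡ second zero → toℕ v < m
      onLeft (inj₁ refl) = ↑ˡ-onLeft a₁
      onLeft (inj₂ refl) = ↑ˡ-onLeft a₂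

      onRight : ∀ {v} → v ≡ first (suc zero) ⊎ v ≡ second (suc zero) → m ≤ toℕ v
      onRight (inj₁ refl) = ↑ʳ-onRight b₁
      onRight (inj₂ refl) = ↑ʳ-onRight b₂

      disjoint : ∀ {i j v} → v ≡ first i ⊎ v ≡ second i → v ≡ first j ⊎ v ≡ second j → i ≡ j
      disjoint {zero}     {zero}     _ _ = refl
      disjoint {suc zero} {suc zero} _ _ = refl
      disjoint {zero}     {suc zero} l r = contradiction (onRight r) (<⇒≱ (onLeft l))
      disjoint {suc zero} {zero}     r l = contradiction (onRight r) (<⇒≱ (onLeft l))

      covers : ∀ v → ∃ λ i → InClosedNbhd (K m n) v (first i) × InClosedNbhd (K m n) v (second i)
      covers v with toℕ v <? m
      ... | yes v<m = suc zero , inj₂ (inj₂ (↑ʳ-onRight b₁ , v<m)) , inj₂ (inj₂ (↑ʳ-onRight b₂ , v<m))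
      ... | no v≮m  = zero , inj₂ (inj₁ (↑ˡ-onLeft a₁ , ≮⇒≥ v≮m)) , inj₂ (inj₁ (↑ˡ-onLeft a₂ , ≮⇒≥ v≮m))

K₁₁-pairing : PairingDominatingSet (K 1 1)
K₁₁-pairing = record
  { size         = 1
  ; first        = λ _ → zero
  ; second       = λ _ → suc zero
  ; first≢second = λ _ ()
  ; disjoint     = λ { {zero} {zero} _ _ → refl }
  ; covers       = λ v → zero , closed zero v , closed (suc zero) v
  }
  where
    closed : ∀ u v → InClosedNbhd (K 1 1) v u
    closed zero       zero       = inj₁ refl
    closed zero       (suc zero) = inj₂ (inj₁ (s≤s z≤n , s≤s z≤n))
    closed (suc zero) zero       = inj₂ (inj₂ (s≤s z≤n , s≤s z≤n))
    closed (suc zero) (suc zero) = inj₁ refl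

module _ {N : ℕ} where

  center-dominates : ∀ {s : Position (K 1 N)} → s zero ≡ dom → Dominated (K 1 N) s
  center-dominates sz zero    = zero , sz , inj₁ refl
  center-dominates sz (suc v) = zero , sz , inj₂ (inj₁ (s≤s z≤n , s≤s z≤n))

  leaf-closedNbhd : ∀ {b : Fin N} {u} → InClosedNbhd (K 1 N) (suc b) u → u ≡ suc b ⊎ u ≡ zero
  leaf-closedNbhd             (inj₁ u≡b)                    = inj₁ u≡b
  leaf-closedNbhd {u = zero}  (inj₂ _)                      = inj₂ refl
  leaf-closedNbhd {u = suc u} (inj₂ (inj₁ (s≤s () , _)))
  leaf-closedNbhd {u = suc u} (inj₂ (inj₂ (_ , s≤s ())))

  center-leaf⇒SWinS : ∀ (s : Position (K 1 N)) b → s zero ≡ stal → s (suc b) ≡ free → SWinS (K 1 N) s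
  center-leaf⇒SWinS s b sz sb = moveS (suc b) sb (owns⇒SWinD (K 1 N) (<-wellFounded _) owns)
    where
      owns : OwnsClosedNbhd (K 1 N) (claim (K 1 N) s (suc b) stal) (suc b)
      owns u∈N[b] with leaf-closedNbhd u∈N[b]
      ... | inj₁ refl = claim-updates (K 1 N) s (suc b) stal
      ... | inj₂ refl = claim-keeps (K 1 N) s (suc b) stal zero sb sz λ ()

star-𝒩 : ∀ n → OutcomeIs (K 1 (suc (suc n))) 𝒩
star-𝒩 n = moveD zero refl (dominated⇒DWinS G (center-dominates (claim-updates G (initial G) zero dom)))
          , moveS zero refl (moveD (λ ap → ap (suc zero) refl) answer)
  where
    G = K 1 (suc (suc n))
    s₁ = claim G (initial G) zero stal

    otherLeaf : (w : Fin (order G)) → Σ (Fin (suc (suc n))) λ b → suc b ≢ w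
    otherLeaf w with w ≟ suc zero
    ... | yes refl = suc zero , λ ()
    ... | no w≢1   = zero , w≢1 ∘ sym

    answer : ∀ w → s₁ w ≡ free → SWinS G (claim G s₁ w dom)
    answer w sw with otherLeaf w
    ... | b , b≢w = center-leaf⇒SWinS _ b (claim-keeps G s₁ w dom zero sw (claim-updates G (initial G) zero stal) λ ())
                                         (claim-minimal G s₁ w dom b≢w)

proposition4p1 : (m n : ℕ) → 1 ≤ m → m ≤ n →
    ((n ≡ 1 × m ≡ 1) → OutcomeIs (K m n) 𝒟) ×
    ((2 ≤ n × 2 ≤ m) → OutcomeIs (K m n) 𝒟) ×
    ((m < n × m ≡ 1) → OutcomeIs (K m n) 𝒩)
proposition4p1 m n _ _ = K₁₁ , K₂₂ , star
  where
    K₁₁ : n ≡ 1 × m ≡ 1 → OutcomeIs (K m n) 𝒟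
    K₁₁ (refl , refl) = pairingDominatingSet⇒𝒟 K₁₁-pairing

    K₂₂ : 2 ≤ n × 2 ≤ m → OutcomeIs (K m n) 𝒟
    K₂₂ (s≤s (s≤s _) , s≤s (s≤s _)) =
      pairingDominatingSet⇒𝒟 (bipartitePairing {a₁ = zero} {suc zero} {zero} {suc zero} (λ ()) (λ ()))

    star : m < n × m ≡ 1 → OutcomeIs (K m n) 𝒩
    star (s≤s (s≤s _) , refl) = star-𝒩 _
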